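{- Suppose $S$ is a free numerical semigroup that is reflective. Then $S=\langle A\rangle$ for a minimal telescopic set $A$ given by one of the following: (1) $A=\{1\}$ (so $g(S)=0$); (2) $A=\{2,4n+3\}$ for some $n\in\mathbb{N}_0$ (so $g(S)=2n+1$); (3) $A=\{3,3n+2\}$ for some $n\in\mathbb{N}_0$ (so $g(S)=3n+1$); (4) $A=\{4,4n+2,4n+3\}$ for some $n\in\mathbb{N}_0$ (so $g(S)=4n+1$).
   Context: A numerical semigroup is a submonoid $S$ of $(\mathbb{N}_0,+)$ with finite complement; $g(S)=\#(\mathbb{N}_0\setminus S)$; $\langle A\rangle$ is the set of finite $\mathbb{N}_0$-linear combinations of elements of $A$. A set $A$ is minimal if no element is such a combination of the others. For a sequence $(a_1,\dots,a_k)$ of non-negative integers, let $d_i=\gcd(a_1,\dots,a_i)$, $S_i=\langle a_1,\dots,a_i\rangle$, and $c_j=d_{j-1}/d_j$ for $2\le j\le k$; the sequence is telescopic if $c_ja_j\in S_{j-1}$ for all $j\in\{2,\dots,k\}$. A set is telescopic if it can be ordered into a telescopic sequence. A numerical semigroup is free if it is generated by a telescopic set. A numerical semigroup $S$ of genus $g\ge1$ is reflective if for every integer $z$ with $0\le z\le g-1$ exactly one of $z$ and $z+g$ lies in $S$; by convention $\mathbb{N}_0$ (genus $0$) is reflective. -}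

module Defs where

open import Data.Nat using (ℕ; zero; suc; _+_; _*_; _≤_; _<_; NonZero)
open import Data.Nat.GCD using (gcd)
open import Data.Nat.DivMod using (_/_)
open import Data.List using (List; []; _∷_; foldr; take; length; lookup)
open import Data.List.Membership.Propositional using (_∈_)
open import Data.List.Relation.Unary.Unique.Propositional using (Unique)
open import Data.List.Relation.Binary.Permutation.Propositional using (_↭_)
open import Data.Fin using (fromℕ<)
open import Data.Product using (Σ; _×_; _,_)
open import Data.Sum using (_⊎_)
open import Relation.Nullary using (¬_)
open import Relation.Binary.PropositionalEquality using (_≡_; _≢_)

SubsetN : Set₁
SubsetN = ℕ → Set

data ⟨_⟩ (P : ℕ → Set) : ℕ → Set where
  gen-zero : ⟨ P ⟩ 0
  gen-add  : ∀ {a x} → P a → ⟨ P ⟩ x → ⟨ P ⟩ (a + x)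

⟨_⟩ₗ : List ℕ → ℕ → Set
⟨ A ⟩ₗ = ⟨ (λ a → a ∈ A) ⟩

_≐_ : SubsetN → SubsetN → Set
S ≐ T = ∀ x → (S x → T x) × (T x → S x)

record IsNumericalSemigroup (S : SubsetN) : Set where
  field
    zero∈  : S 0
    +-closed : ∀ {x y} → S x → S y → S (x + y)
    cofinite : Σ ℕ λ N → ∀ n → N ≤ n → S n

HasGenus : SubsetN → ℕ → Set
HasGenus S g = Σ (List ℕ) λ L →
  Unique L × (∀ x → (x ∈ L → ¬ S x) × (¬ S x → x ∈ L)) × length L ≡ g

-- gcd of a finite sequence (gcd of the empty sequence is 0).
gcdL : List ℕ → ℕ
gcdL = foldr gcd 0

-- total division, with the (irrelevant) convention m / 0 = 0.
_div_ : ℕ → ℕ → ℕ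
m div zero = 0
m div suc n = m / suc n

-- Telescopic sequence (a₁,…,a_k): for every j ∈ {2,…,k},
-- c_j a_j ∈ S_{j-1} where c_j = d_{j-1}/d_j.
-- Here i = j - 1 (0-based index of a_j), i.e. prefix take i l = (a₁,…,a_{j-1}).
IsTelescopicSeq : List ℕ → Set
IsTelescopicSeq l = ∀ i → 1 ≤ i → (i<k : i < length l) →
  ⟨ take i l ⟩ₗ ((gcdL (take i l) div gcdL (take (suc i) l)) * lookup l (fromℕ< i<k))

IsTelescopicSet : List ℕ → Set
IsTelescopicSet A = Σ (List ℕ) λ l → (l ↭ A) × IsTelescopicSeq l

IsMinimal : List ℕ → Set
IsMinimal A = ∀ a → a ∈ A → ¬ ⟨ (λ b → b ∈ A × b ≢ a) ⟩ a

IsFree : SubsetN → Set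
IsFree S = Σ (List ℕ) λ A → Unique A × IsTelescopicSet A × (S ≐ ⟨ A ⟩ₗ)

-- Reflective: if g(S) = g ≥ 1, then for every 0 ≤ z ≤ g-1 exactly one of
-- z, z+g lies in S (genus 0, i.e. S = ℕ₀, is reflective by convention).
IsReflective : SubsetN → Set
IsReflective S = ∀ g → HasGenus S g → 1 ≤ g → ∀ z → z < g →
  (S z × ¬ S (z + g)) ⊎ (¬ S z × S (z + g))

-- A reflective semigroup of genus g ≥ 1 already has g gaps below 2g (one of z and z + g for each
-- z < g), so everything from 2g on lies in S.  With m the multiplicity, reflectivity forces the
-- elements below g to be multiples of m and puts g + z (z < g) in S exactly when m ∤ z; hence m,
-- the g + z with 0 < z < m and m ∤ g + z, and 2g + 1 when m ∣ g + 1 are minimal generators.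
-- In a telescopic sequence everything after the shortest prefix with gcd 1 is redundant, so all
-- minimal generators but one, x, are divisible by the gcd d ≥ 2 of the prefix before it.  Every
-- coprime pair of minimal generators must then contain x, which rules out m ≥ 5 and every g with
-- g ≢ 1 (mod m); the surviving shapes are generated by the listed sets.

module Submission where

open import Defs
open import Data.Empty using (⊥; ⊥-elim)
open import Function using (_∘_)
open import Data.Fin using (Fin; toℕ; fromℕ<)
open import Data.Fin.Properties using (toℕ<n; toℕ-injective)
open import Data.List using (List; []; _∷_; length; take; lookup; tabulate; filter; upTo)
open import Data.List.Membership.Propositional using (_∈_; find; lose)
open import Data.List.Membership.Propositional.Properties using (∈-tabulate⁻; ∈-filter⁺; ∈-filter⁻; ∈-upTo⁺)
open import Data.List.Properties using (length-tabulate; take-all)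
import Data.List.Relation.Unary.All as All
open import Data.List.Relation.Unary.AllPairs using (_∷_)
open import Data.List.Relation.Unary.Any using (Any; here; there; any?)
open import Data.List.Relation.Unary.Unique.Propositional using (Unique)
open import Data.List.Relation.Unary.Unique.Propositional.Properties
  using (tabulate⁺; filter⁺; upTo⁺; Unique[x∷xs]⇒x∉xs)
open import Data.List.Relation.Binary.Permutation.Propositional using (_↭_; ↭-refl; ↭-sym)
open import Data.List.Relation.Binary.Permutation.Propositional.Properties using (∈-resp-↭)
open import Data.Nat
open import Data.Nat.Divisibility
open import Data.Nat.DivMod using (_/_; _%_; m≡m%n+[m/n]*n; m%n<n; n/1≡n)
open import Data.Nat.GCD using (gcd[m,n]∣m; gcd[m,n]∣n; gcd-greatest)
open import Data.Nat.Coprimality using (Coprime) renaming (sym to coprime-sym)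
open import Data.Nat.Induction using (<-rec)
open import Data.Nat.Properties
open import Data.Nat.Tactic.RingSolver using (solve)
open import Data.Product using (Σ; ∃; ∃₂; _×_; _,_; proj₁; proj₂)
open import Data.Sum using (_⊎_; inj₁; inj₂)
open import Relation.Nullary using (Dec; yes; no; ¬_; ¬?; contradiction)
open import Relation.Nullary.Decidable using (map′; _×-dec_; from-no)
open import Relation.Unary using (Decidable)
open import Relation.Binary.PropositionalEquality

private
  variable
    P Q S : ℕ → Set
    a n x y : ℕ

divMod : ∀ n {m} → 0 < m → ∃₂ λ q r → r < m × n ≡ m * q + r
divMod n {suc m} _ = n / suc m , n % suc m , m%n<n n (suc m) ,
  trans (m≡m%n+[m/n]*n n (suc m))
        (trans (+-comm (n % suc m) _) (cong (_+ n % suc m) (*-comm (n / suc m) (suc m))))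

shift-injective : ∀ {g i j y} → i < g → j < g → y ≡ i ⊎ y ≡ i + g → y ≡ j ⊎ y ≡ j + g → i ≡ j
shift-injective _   _   (inj₁ refl) (inj₁ refl) = refl
shift-injective {g} i<g _ (inj₁ refl) (inj₂ refl) = contradiction (m≤n+m g _) (<⇒≱ i<g)
shift-injective {g} _ j<g (inj₂ refl) (inj₁ refl) = contradiction (m≤n+m g _) (<⇒≱ j<g)
shift-injective {g} _ _ (inj₂ refl) (inj₂ i+g≡j+g) = +-cancelʳ-≡ g _ _ i+g≡j+g

≢0∧≢1⇒2≤ : n ≢ 0 → n ≢ 1 → 2 ≤ n
≢0∧≢1⇒2≤ {zero}        n≢0 _   = contradiction refl n≢0
≢0∧≢1⇒2≤ {suc zero}    _   n≢1 = contradiction refl n≢1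
≢0∧≢1⇒2≤ {suc (suc _)} _   _   = s≤s (s≤s z≤n)

-- Conclusions are spelled `… → ⊥` rather than `¬ …` so that a `solve` in the equation argument
-- already sees both sides of the equation.
∤-near-multiple : ∀ {d} x → d ∣ a → n ≡ a + x → 0 < x → x < d → d ∣ n → ⊥
∤-near-multiple _ d∣a refl 0<x x<d d∣n = <⇒≱ x<d (∣⇒≤ ⦃ >-nonZero 0<x ⦄ (∣m+n∣m⇒∣n d∣n d∣a))

≢-offset : ∀ c → n ≡ a + suc c → n ≡ a → ⊥
≢-offset {a = a} c refl = >⇒≢ (m<m+n a z<s)

∤⇒≢ : ∀ {m} → ¬ m ∣ n → n ≢ m
∤⇒≢ m∤n refl = m∤n ∣-refl

coprime-by : ∀ u a v n → u * a ≡ v * n + 1 → Coprime a n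
coprime-by u _ v _ eq {i} (i∣a , i∣n) =
  ∣1⇒≡1 (∣m+n∣m⇒∣n (subst (i ∣_) eq (∣n⇒∣m*n u i∣a)) (∣n⇒∣m*n v i∣n))

least : Decidable P → P n → ∃ λ k → P k × (∀ {j} → j < k → ¬ P j)
least {P = P} P? = <-rec (λ n → P n → Least) step _
  where
    Least = ∃ λ k → P k × (∀ {j} → j < k → ¬ P j)
    step : ∀ n → (∀ {k} → k < n → P k → Least) → P n → Least
    step n rec pn with anyUpTo? P? n
    ... | yes (k , k<n , pk) = rec k<n pk
    ... | no none            = n , pn , λ j<n pj → none (_ , j<n , pj)

-- Generated submonoids of ℕ

⟨⟩-+ : ⟨ P ⟩ x → ⟨ P ⟩ y → ⟨ P ⟩ (x + y)
⟨⟩-+ gen-zero py = py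
⟨⟩-+ {P = P} {y = y} (gen-add {a} {x} pa px) py =
  subst ⟨ P ⟩ (sym (+-assoc a x y)) (gen-add pa (⟨⟩-+ px py))

⟨⟩-gen : P a → ⟨ P ⟩ a
⟨⟩-gen {P = P} {a} pa = subst ⟨ P ⟩ (+-identityʳ a) (gen-add pa gen-zero)

⟨⟩-* : ∀ k → P a → ⟨ P ⟩ (k * a)
⟨⟩-* zero    pa = gen-zero
⟨⟩-* (suc k) pa = gen-add pa (⟨⟩-* k pa)

⟨⟩-via : ⟨ P ⟩ x → x ≡ y → ⟨ P ⟩ y
⟨⟩-via {P = P} px x≡y = subst ⟨ P ⟩ x≡y px

⟨⟩-bind : (∀ {a} → P a → ⟨ Q ⟩ a) → ⟨ P ⟩ x → ⟨ Q ⟩ x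
⟨⟩-bind f gen-zero        = gen-zero
⟨⟩-bind f (gen-add pa px) = ⟨⟩-+ (f pa) (⟨⟩-bind f px)

⟨⟩-∣-bounded : ∀ {d} → (∀ {b} → P b → b ≤ y → d ∣ b) → ⟨ P ⟩ y → d ∣ y
⟨⟩-∣-bounded {d = d} f gen-zero = d ∣0
⟨⟩-∣-bounded f (gen-add {a} {x} pa px) =
  ∣m∣n⇒∣m+n (f pa (m≤m+n a x)) (⟨⟩-∣-bounded (λ pb b≤x → f pb (≤-trans b≤x (m≤n+m x a))) px)

⟨⟩-∣ : ∀ {d} → (∀ {b} → P b → d ∣ b) → ⟨ P ⟩ y → d ∣ y
⟨⟩-∣ f = ⟨⟩-∣-bounded (λ pb _ → f pb)

⟨⟩-unfold : ⟨ P ⟩ y → 0 < y → ∃ λ a → P a × 0 < a × a ≤ y × ⟨ P ⟩ (y ∸ a)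
⟨⟩-unfold (gen-add {zero} pa px) 0<y = ⟨⟩-unfold px 0<y
⟨⟩-unfold {P = P} (gen-add {suc a} {x} pa px) _ =
  suc a , pa , z<s , m≤m+n (suc a) x , subst ⟨ P ⟩ (sym (m+n∸m≡n (suc a) x)) px

⟨⟩ₗ-dec : ∀ A → Decidable ⟨ A ⟩ₗ
⟨⟩ₗ-dec A = <-rec (λ y → Dec (⟨ A ⟩ₗ y)) step
  where
    Peel : ℕ → ℕ → Set
    Peel y a = 0 < a × a ≤ y × ⟨ A ⟩ₗ (y ∸ a)

    peel? : ∀ y → (∀ {k} → k < y → Dec (⟨ A ⟩ₗ k)) → ∀ a → Dec (Peel y a)
    peel? y rec a with 0 <? a | a ≤? y
    ... | no a≯0 | _      = no λ (0<a , _) → a≯0 0<a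
    ... | yes _  | no a≰y = no λ (_ , a≤y , _) → a≰y a≤y
    ... | yes 0<a | yes a≤y =
      map′ (λ p → 0<a , a≤y , p) (λ (_ , _ , p) → p) (rec (∸-monoʳ-< 0<a a≤y))

    step : ∀ y → (∀ {k} → k < y → Dec (⟨ A ⟩ₗ k)) → Dec (⟨ A ⟩ₗ y)
    step zero    _   = yes gen-zero
    step (suc y) rec = map′ combine split (any? (peel? (suc y) rec) A)
      where
        combine : Any (Peel (suc y)) A → ⟨ A ⟩ₗ (suc y)
        combine any with find any
        ... | a , a∈A , (_ , a≤y , rest) = ⟨⟩-via (gen-add a∈A rest) (m+[n∸m]≡n a≤y)
        split : ⟨ A ⟩ₗ (suc y) → Any (Peel (suc y)) A
        split p with ⟨⟩-unfold p z<s
        ... | a , a∈A , 0<a , a≤y , rest = lose a∈A (0<a , a≤y , rest)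

¬⟨others⟩-by-divisor : ∀ {A : List ℕ} {a} d → ¬ d ∣ a →
  (∀ {b} → b ∈ A → b ≢ a → b ≤ a → d ∣ b) →
  ¬ ⟨ (λ b → b ∈ A × b ≢ a) ⟩ a
¬⟨others⟩-by-divisor d d∤a small = d∤a ∘ ⟨⟩-∣-bounded (λ (b∈A , b≢a) → small b∈A b≢a)

≐⟨⟩ₗ-decidable : ∀ {A} → S ≐ ⟨ A ⟩ₗ → Decidable S
≐⟨⟩ₗ-decidable {A = A} S≐A y = map′ (proj₂ (S≐A y)) (proj₁ (S≐A y)) (⟨⟩ₗ-dec A y)

≐-resp-↭ : ∀ {l A} → l ↭ A → S ≐ ⟨ A ⟩ₗ → S ≐ ⟨ l ⟩ₗ
≐-resp-↭ l↭A S≐A y = ⟨⟩-bind (⟨⟩-gen ∘ ∈-resp-↭ (↭-sym l↭A)) ∘ proj₁ (S≐A y)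
                   , proj₂ (S≐A y) ∘ ⟨⟩-bind (⟨⟩-gen ∘ ∈-resp-↭ l↭A)

∈-remove : ∀ {A : Set} {x : A} ys → x ∈ ys →
  ∃ λ zs → length ys ≡ suc (length zs) × (∀ {y} → y ∈ ys → y ≢ x → y ∈ zs)
∈-remove (_ ∷ ys) (here refl) = ys , refl , λ where
  (here refl) y≢x → contradiction refl y≢x
  (there y∈)  _   → y∈
∈-remove (z ∷ ys) (there x∈) with ∈-remove ys x∈
... | zs , len , sub = z ∷ zs , cong suc len , λ where
  (here refl) _   → here refl
  (there y∈)  y≢x → there (sub y∈ y≢x)

length-≤-⊆ : ∀ {A : Set} {xs ys : List A} → Unique xs → (∀ {y} → y ∈ xs → y ∈ ys) →
  length xs ≤ length ys
length-≤-⊆ {xs = []} _ _ = z≤n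
length-≤-⊆ {xs = x ∷ xs} {ys} u@(_ ∷ u′) xs⊆ys with ∈-remove ys (xs⊆ys (here refl))
... | zs , len , sub = subst (suc (length xs) ≤_) (sym len) (s≤s (length-≤-⊆ u′ xs⊆zs))
  where
    xs⊆zs : ∀ {y} → y ∈ xs → y ∈ zs
    xs⊆zs y∈ = sub (xs⊆ys (there y∈)) λ { refl → Unique[x∷xs]⇒x∉xs u y∈ }

∈-take⁻ : ∀ {A : Set} {x : A} n xs → x ∈ take n xs → x ∈ xs
∈-take⁻ (suc n) (_ ∷ xs) (here refl) = here refl
∈-take⁻ (suc n) (_ ∷ xs) (there x∈) = there (∈-take⁻ n xs x∈)

∈-take-suc⁺ : ∀ {A : Set} {x : A} n xs → x ∈ take n xs → x ∈ take (suc n) xs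
∈-take-suc⁺ (suc n) (_ ∷ xs) (here refl) = here refl
∈-take-suc⁺ (suc n) (_ ∷ xs) (there x∈) = there (∈-take-suc⁺ n xs x∈)

∈-take-suc⁻ : ∀ {A : Set} {x : A} n xs → x ∈ take (suc n) xs →
  x ∈ take n xs ⊎ Σ (n < length xs) λ n<len → x ≡ lookup xs (fromℕ< n<len)
∈-take-suc⁻ zero    (_ ∷ xs) (here refl) = inj₂ (z<s , refl)
∈-take-suc⁻ (suc n) (_ ∷ xs) (here refl) = inj₁ (here refl)
∈-take-suc⁻ (suc n) (_ ∷ xs) (there x∈) with ∈-take-suc⁻ n xs x∈
... | inj₁ x∈take         = inj₁ (there x∈take)
... | inj₂ (n<len , x≡xₙ) = inj₂ (s<s n<len , x≡xₙ)

lookup-∈-take-suc : ∀ {A : Set} i (xs : List A) (i<len : i < length xs) →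
  lookup xs (fromℕ< i<len) ∈ take (suc i) xs
lookup-∈-take-suc zero    (_ ∷ xs) _           = here refl
lookup-∈-take-suc (suc i) (_ ∷ xs) (s<s i<len) = there (lookup-∈-take-suc i xs i<len)

gcdL-∣ : ∀ xs → x ∈ xs → gcdL xs ∣ x
gcdL-∣ (y ∷ ys) (here refl) = gcd[m,n]∣m y (gcdL ys)
gcdL-∣ (y ∷ ys) (there x∈) = ∣-trans (gcd[m,n]∣n y (gcdL ys)) (gcdL-∣ ys x∈)

gcdL-greatest : ∀ {d} xs → (∀ {x} → x ∈ xs → d ∣ x) → d ∣ gcdL xs
gcdL-greatest {d} []       _ = d ∣0
gcdL-greatest (x ∷ xs) d∣ = gcd-greatest (d∣ (here refl)) (gcdL-greatest xs (d∣ ∘ there))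

gcdL-take-suc-∣ : ∀ n xs → gcdL (take (suc n) xs) ∣ gcdL (take n xs)
gcdL-take-suc-∣ n xs = gcdL-greatest (take n xs) (gcdL-∣ (take (suc n) xs) ∘ ∈-take-suc⁺ n xs)

gcdL-take-suc-≡1 : ∀ n xs → gcdL (take n xs) ≡ 1 → gcdL (take (suc n) xs) ≡ 1
gcdL-take-suc-≡1 n xs gcd≡1 = ∣1⇒≡1 (subst (gcdL (take (suc n) xs) ∣_) gcd≡1 (gcdL-take-suc-∣ n xs))

gcdL-singleton : ∀ a → gcdL (a ∷ []) ≡ a
gcdL-singleton a = ∣-antisym (gcdL-∣ (a ∷ []) (here refl)) (gcdL-greatest (a ∷ []) λ { (here refl) → ∣-refl })

-- Numerical semigroups and minimal generators

⟨⟩-⊆ : IsNumericalSemigroup S → (∀ {a} → P a → S a) → ⟨ P ⟩ x → S x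
⟨⟩-⊆ ns P⊆S gen-zero        = IsNumericalSemigroup.zero∈ ns
⟨⟩-⊆ ns P⊆S (gen-add pa px) = IsNumericalSemigroup.+-closed ns (P⊆S pa) (⟨⟩-⊆ ns P⊆S px)

multiple-∈ : IsNumericalSemigroup S → S a → a ∣ x → S x
multiple-∈ ns sa (divides k refl) = ⟨⟩-⊆ ns (λ s → s) (⟨⟩-* k sa)

genus : Decidable S → IsNumericalSemigroup S → ∃ (HasGenus S)
genus {S} S? ns = length gaps , gaps , filter⁺ gap? (upTo⁺ N) , gaps-complete , refl
  where
    N = proj₁ (IsNumericalSemigroup.cofinite ns)
    gap? : Decidable (λ x → ¬ S x)
    gap? x = ¬? (S? x)
    gaps = filter gap? (upTo N)
    gaps-complete : ∀ x → (x ∈ gaps → ¬ S x) × (¬ S x → x ∈ gaps)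
    gaps-complete x =
      proj₂ ∘ ∈-filter⁻ gap? {xs = upTo N} , λ x∉S → ∈-filter⁺ gap? (∈-upTo⁺ (x<N x∉S)) x∉S
      where
        x<N : ¬ S x → x < N
        x<N x∉S = ≰⇒> λ N≤x → x∉S (proj₂ (IsNumericalSemigroup.cofinite ns) x N≤x)

gcdL-generators≡1 : ∀ {l} → IsNumericalSemigroup S → (S ≐ ⟨ l ⟩ₗ) → gcdL l ≡ 1
gcdL-generators≡1 {S} {l} ns S≐l =
  ∣1⇒≡1 (∣m+n∣m⇒∣n (subst (gcdL l ∣_) (+-comm 1 N) (gcdL-∣S (beyond-N (n≤1+n N))))
                   (gcdL-∣S (beyond-N ≤-refl)))
  where
    N = proj₁ (IsNumericalSemigroup.cofinite ns)
    beyond-N : ∀ {y} → N ≤ y → S y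
    beyond-N = proj₂ (IsNumericalSemigroup.cofinite ns) _
    gcdL-∣S : ∀ {y} → S y → gcdL l ∣ y
    gcdL-∣S y∈S = ⟨⟩-∣ (gcdL-∣ l) (proj₁ (S≐l _) y∈S)

MinimalGenerator : (ℕ → Set) → ℕ → Set
MinimalGenerator S y = S y × 0 < y × (∀ {s t} → S s → S t → s + t ≡ y → s ≡ 0 ⊎ t ≡ 0)

minimalGenerator-∈ : IsNumericalSemigroup S → MinimalGenerator S y → (∀ {a} → P a → S a) →
  ⟨ P ⟩ y → P y
minimalGenerator-∈ ns (_ , () , _) P⊆S gen-zero
minimalGenerator-∈ {P = P} ns mg@(_ , _ , irreducible) P⊆S (gen-add {a} pa px)
  with irreducible (P⊆S pa) (⟨⟩-⊆ ns P⊆S px) refl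
... | inj₁ refl = minimalGenerator-∈ ns mg P⊆S px
... | inj₂ refl = subst P (sym (+-identityʳ a)) pa

-- Reflective numerical semigroups

record ReflectiveShape (S : ℕ → Set) (m g : ℕ) : Set where
  field
    0<g        : 0 < g
    0<m        : 0 < m
    m∈S        : S m
    m-least    : ∀ {k} → 0 < k → S k → m ≤ k
    m∣-below-g : ∀ {z} → z < g → S z → m ∣ z
    m∤-above-g : ∀ {z} → z < g → S (g + z) → ¬ m ∣ z
    above-g∈S  : ∀ {z} → 0 < z → z < m → S (g + z)
    conductor  : ∀ {y} → g + g ≤ y → S y

module Reflective {S : ℕ → Set} (S? : Decidable S) (ns : IsNumericalSemigroup S)
    {g} (hg : HasGenus S g) (0<g : 0 < g)
    (reflect : ∀ z → z < g → (S z × ¬ S (z + g)) ⊎ (¬ S z × S (z + g))) where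

  open IsNumericalSemigroup ns

  ∉⇒+g∈ : ∀ {z} → z < g → ¬ S z → S (z + g)
  ∉⇒+g∈ z<g z∉S with reflect _ z<g
  ... | inj₁ (z∈S , _)   = contradiction z∈S z∉S
  ... | inj₂ (_ , z+g∈S) = z+g∈S

  ∈⇒+g∉ : ∀ {z} → z < g → S z → ¬ S (z + g)
  ∈⇒+g∉ z<g z∈S with reflect _ z<g
  ... | inj₁ (_ , z+g∉S) = z+g∉S
  ... | inj₂ (z∉S , _)   = contradiction z∈S z∉S

  partnerGap : ∀ z → z < g → ∃ λ y → ¬ S y × (y ≡ z ⊎ y ≡ z + g)
  partnerGap z z<g with reflect z z<g
  ... | inj₁ (_ , z+g∉S) = z + g , z+g∉S , inj₂ refl
  ... | inj₂ (z∉S , _)   = z , z∉S , inj₁ refl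

  partnerGaps : List ℕ
  partnerGaps = tabulate (λ (i : Fin g) → proj₁ (partnerGap (toℕ i) (toℕ<n i)))

  partnerGaps-unique : Unique partnerGaps
  partnerGaps-unique = tabulate⁺ λ {i} {j} eq → toℕ-injective (shift-injective (toℕ<n i) (toℕ<n j)
    (proj₂ (proj₂ (partnerGap _ (toℕ<n i))))
    (subst (λ y → y ≡ toℕ j ⊎ y ≡ toℕ j + g) (sym eq) (proj₂ (proj₂ (partnerGap _ (toℕ<n j))))))

  partnerGap-bounds : ∀ {y} → y ∈ partnerGaps → ¬ S y × y < g + g
  partnerGap-bounds y∈ with ∈-tabulate⁻ y∈
  ... | i , refl with partnerGap (toℕ i) (toℕ<n i)
  ...   | _ , y∉S , inj₁ refl = y∉S , ≤-trans (toℕ<n i) (m≤m+n g g)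
  ...   | _ , y∉S , inj₂ refl = y∉S , +-monoˡ-< g (toℕ<n i)

  -- The g gaps supplied by reflectivity all lie below 2g, and S has only g gaps.
  conductor : ∀ {y} → g + g ≤ y → S y
  conductor {y} 2g≤y with S? y
  ... | yes y∈S = y∈S
  ... | no  y∉S = ⊥-elim (n≮n _ (≤-trans (length-≤-⊆ unique gaps) (≤-reflexive (sym eq))))
    where
      L = proj₁ hg
      is-gap = proj₁ (proj₂ (proj₂ hg))
      eq : length partnerGaps ≡ length L
      eq = trans (length-tabulate _) (sym (proj₂ (proj₂ (proj₂ hg))))
      unique : Unique (y ∷ partnerGaps)
      unique = All.tabulate (λ z∈ y≡z → <⇒≱ (proj₂ (partnerGap-bounds z∈)) (subst (g + g ≤_) y≡z 2g≤y))
               ∷ partnerGaps-unique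
      gaps : ∀ {z} → z ∈ y ∷ partnerGaps → z ∈ L
      gaps (here refl) = proj₂ (is-gap y) y∉S
      gaps (there z∈)  = proj₂ (is-gap _) (proj₁ (partnerGap-bounds z∈))

  private
    multiplicity : ∃ λ m → (0 < m × S m) × (∀ {k} → k < m → ¬ (0 < k × S k))
    multiplicity = least (λ k → (0 <? k) ×-dec S? k) (≤-trans 0<g (m≤m+n g g) , conductor ≤-refl)

  m : ℕ
  m = proj₁ multiplicity

  0<m : 0 < m
  0<m = proj₁ (proj₁ (proj₂ multiplicity))

  m∈S : S m
  m∈S = proj₂ (proj₁ (proj₂ multiplicity))

  below-m-∉ : ∀ {k} → 0 < k → k < m → ¬ S k
  below-m-∉ 0<k k<m k∈S = proj₂ (proj₂ multiplicity) k<m (0<k , k∈S)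

  -- A nonzero remainder r of z is a gap, so r + g ∈ S and hence z + g ∈ S, against reflectivity.
  m∣-below-g : ∀ {z} → z < g → S z → m ∣ z
  m∣-below-g {z} z<g z∈S with divMod z 0<m
  ... | q , zero  , _   , refl = divides q (trans (+-identityʳ (m * q)) (*-comm m q))
  ... | q , suc r , r<m , refl = ⊥-elim (∈⇒+g∉ z<g z∈S (subst S (sym (+-assoc (m * q) (suc r) g)) z+g∈S))
    where
      z+g∈S : S (m * q + (suc r + g))
      z+g∈S = +-closed (multiple-∈ ns m∈S (m∣m*n q))
                (∉⇒+g∈ (≤-<-trans (m≤n+m (suc r) (m * q)) z<g) (below-m-∉ z<s r<m))

  shape : ReflectiveShape S m g
  shape = record
    { 0<g        = 0<g
    ; 0<m        = 0<m
    ; m∈S        = m∈S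
    ; m-least    = λ 0<k k∈S → ≮⇒≥ λ k<m → below-m-∉ 0<k k<m k∈S
    ; m∣-below-g = m∣-below-g
    ; m∤-above-g = λ z<g g+z∈S m∣z → ∈⇒+g∉ z<g (multiple-∈ ns m∈S m∣z) (subst S (+-comm g _) g+z∈S)
    ; above-g∈S  = above-g∈S
    ; conductor  = conductor
    }
    where
      above-g∈S : ∀ {z} → 0 < z → z < m → S (g + z)
      above-g∈S {z} 0<z z<m with z <? g
      ... | yes z<g = subst S (+-comm z g) (∉⇒+g∈ z<g (below-m-∉ 0<z z<m))
      ... | no  z≮g = conductor (+-monoʳ-≤ g (≮⇒≥ z≮g))

reflective-shape : Decidable S → IsNumericalSemigroup S → ∀ {g} → HasGenus S g → 0 < g →
  (∀ z → z < g → (S z × ¬ S (z + g)) ⊎ (¬ S z × S (z + g))) → ∃ λ m → ReflectiveShape S m g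
reflective-shape S? ns hg 0<g reflect = m , shape
  where open Reflective S? ns hg 0<g reflect

module ShapeProperties {S : ℕ → Set} (ns : IsNumericalSemigroup S) {m g} (shape : ReflectiveShape S m g) where

  open ReflectiveShape shape

  g∉S : ¬ S g
  g∉S g∈S = m∤-above-g 0<g (subst S (sym (+-identityʳ g)) g∈S) (m ∣0)

  m∤g : ¬ m ∣ g
  m∤g = g∉S ∘ multiple-∈ ns m∈S

  2≤m : 2 ≤ m
  2≤m = ≢0∧≢1⇒2≤ (>⇒≢ 0<m) λ { refl → m∤g (1∣ g) }

  1∉S : ¬ S 1
  1∉S 1∈S = <⇒≱ 2≤m (m-least z<s 1∈S)

  m≤g+1 : m ≤ g + 1
  m≤g+1 = m-least (m≤n+m 1 g) (above-g∈S z<s 2≤m)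

  minimal-if : S y → 0 < y → (∀ {s t} → S s → S t → m ≤ s → m ≤ t → s + t ≡ y → ⊥) →
    MinimalGenerator S y
  minimal-if y∈S 0<y no-split = y∈S , 0<y , split
    where
      split : ∀ {s t} → S s → S t → s + t ≡ _ → s ≡ 0 ⊎ t ≡ 0
      split {zero}          _   _   _ = inj₁ refl
      split {suc _} {zero}  _   _   _ = inj₂ refl
      split {suc _} {suc _} s∈S t∈S eq = ⊥-elim (no-split s∈S t∈S (m-least z<s s∈S) (m-least z<s t∈S) eq)

  minimal-m : MinimalGenerator S m
  minimal-m = minimal-if m∈S 0<m λ _ _ m≤s m≤t s+t≡m →
    <⇒≱ (m<m+n m 0<m) (≤-trans (+-mono-≤ m≤s m≤t) (≤-reflexive s+t≡m))

  summand-below-g : ∀ {s t z} → m ≤ t → s + t ≡ g + z → z < m → s < g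
  summand-below-g {s} {t} {z} m≤t eq z<m = ≰⇒> λ g≤s →
    <⇒≱ z<m (+-cancelˡ-≤ g m z (≤-trans (+-mono-≤ g≤s m≤t) (≤-reflexive eq)))

  minimal-above : ∀ {z} → 0 < z → z < m → ¬ m ∣ g + z → MinimalGenerator S (g + z)
  minimal-above {z} 0<z z<m m∤g+z = minimal-if (above-g∈S 0<z z<m) (<-≤-trans 0<z (m≤n+m z g))
    λ {s} {t} s∈S t∈S m≤s m≤t s+t≡g+z → m∤g+z (subst (m ∣_) s+t≡g+z (∣m∣n⇒∣m+n
      (m∣-below-g (summand-below-g m≤t s+t≡g+z z<m) s∈S)
      (m∣-below-g (summand-below-g m≤s (trans (+-comm t s) s+t≡g+z) z<m) t∈S)))

  -- s = g + z with z + t = g + 1, so m ∣ z, which m∤-above-g forbids.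
  no-straddling-split : m ∣ g + 1 → ∀ {s t} → g ≤ s → t < g → S s → S t → m ≤ t →
    s + t ≡ suc (g + g) → ⊥
  no-straddling-split m∣g+1 {s} {t} g≤s t<g s∈S t∈S m≤t eq =
    m∤-above-g z<g (subst S (sym g+z≡s) s∈S) m∣z
    where
      z = s ∸ g
      g+z≡s : g + z ≡ s
      g+z≡s = m+[n∸m]≡n g≤s
      z+t≡g+1 : z + t ≡ g + 1
      z+t≡g+1 = +-cancelˡ-≡ g _ _ (begin
        g + (z + t) ≡⟨ sym (+-assoc g z t) ⟩
        g + z + t   ≡⟨ cong (_+ t) g+z≡s ⟩
        s + t       ≡⟨ eq ⟩
        suc (g + g) ≡⟨ solve (g ∷ []) ⟩
        g + (g + 1) ∎)
        where open ≡-Reasoning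
      z<g : z < g
      z<g = +-cancelʳ-≤ 1 (suc z) g (begin
        suc z + 1 ≡⟨ sym (+-suc z 1) ⟩
        z + 2     ≤⟨ +-monoʳ-≤ z (≤-trans 2≤m m≤t) ⟩
        z + t     ≡⟨ z+t≡g+1 ⟩
        g + 1     ∎)
        where open ≤-Reasoning
      m∣z : m ∣ z
      m∣z = ∣m+n∣m⇒∣n (subst (m ∣_) (trans (sym z+t≡g+1) (+-comm z t)) m∣g+1) (m∣-below-g t<g t∈S)

  minimal-2g+1 : m ∣ g + 1 → MinimalGenerator S (suc (g + g))
  minimal-2g+1 m∣g+1 = minimal-if (conductor (n≤1+n _)) z<s no-split
    where
      beyond-g : ∀ {k} → ¬ k < g → S k → g < k
      beyond-g k≮g k∈S = ≤∧≢⇒< (≮⇒≥ k≮g) λ g≡k → g∉S (subst S (sym g≡k) k∈S)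
      no-split : ∀ {s t} → S s → S t → m ≤ s → m ≤ t → s + t ≡ suc (g + g) → ⊥
      no-split {s} {t} s∈S t∈S m≤s m≤t eq with s <? g | t <? g
      ... | yes s<g | yes t<g = <-asym (+-mono-< s<g t<g) (subst (g + g <_) (sym eq) ≤-refl)
      ... | no s≮g  | yes t<g = no-straddling-split m∣g+1 (≮⇒≥ s≮g) t<g s∈S t∈S m≤t eq
      ... | yes s<g | no t≮g  = no-straddling-split m∣g+1 (≮⇒≥ t≮g) s<g t∈S s∈S m≤s (trans (+-comm t s) eq)
      ... | no s≮g  | no t≮g  = n≮n _ (begin
            suc (suc (g + g)) ≡⟨ cong suc (sym (+-suc g g)) ⟩
            suc g + suc g     ≤⟨ +-mono-≤ (beyond-g s≮g s∈S) (beyond-g t≮g t∈S) ⟩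
            s + t             ≡⟨ eq ⟩
            suc (g + g)       ∎)
        where open ≤-Reasoning

-- Telescopic sequences

module Telescopic {l : List ℕ} (telescopic : IsTelescopicSeq l) where

  absorb-next : ∀ {i} → 1 ≤ i → gcdL (take i l) ≡ 1 → ⟨ take (suc i) l ⟩ₗ x → ⟨ take i l ⟩ₗ x
  absorb-next {i = i} 1≤i gcd≡1 = ⟨⟩-bind generator
    where
      generator : ∀ {a} → a ∈ take (suc i) l → ⟨ take i l ⟩ₗ a
      generator a∈ with ∈-take-suc⁻ i l a∈
      ... | inj₁ a∈take        = ⟨⟩-gen a∈take
      ... | inj₂ (i<len , refl) = ⟨⟩-via (telescopic i 1≤i i<len) (trans
        (cong₂ (λ c c′ → (c div c′) * lookup l (fromℕ< i<len)) gcd≡1 (gcdL-take-suc-≡1 i l gcd≡1))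
        (*-identityˡ _))

  coprime-prefix-generates : ∀ {n} → 1 ≤ n → gcdL (take n l) ≡ 1 → ⟨ l ⟩ₗ x → ⟨ take n l ⟩ₗ x
  coprime-prefix-generates {n = n} 1≤n gcd≡1 x∈ =
    shrink (length l) (subst (λ l′ → ⟨ l′ ⟩ₗ _) (sym (take-all _ l (m≤m+n _ n))) x∈)
    where
      coprime : ∀ k → gcdL (take (k + n) l) ≡ 1
      coprime zero    = gcd≡1
      coprime (suc k) = gcdL-take-suc-≡1 (k + n) l (coprime k)
      shrink : ∀ k → ⟨ take (k + n) l ⟩ₗ x → ⟨ take n l ⟩ₗ x
      shrink zero    = λ p → p
      shrink (suc k) = shrink k ∘ absorb-next (≤-trans 1≤n (m≤n+m n k)) (coprime k)

  exceptional-generator : IsNumericalSemigroup S → (S ≐ ⟨ l ⟩ₗ) → ¬ S 1 →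
    ∃₂ λ x d → 2 ≤ d × (∀ {y} → MinimalGenerator S y → d ∣ y ⊎ y ≡ x)
  exceptional-generator {S} ns S≐l 1∉S
    with least {n = length l} (λ n → gcdL (take n l) ≟ 1)
               (trans (cong gcdL (take-all (length l) l ≤-refl)) (gcdL-generators≡1 ns S≐l))
  ... | zero  , () , _
  ... | suc i , gcd≡1 , earlier with i <? length l
  ...   | no i≮len = contradiction (trans (cong gcdL take-i≡take-1+i) gcd≡1) (earlier ≤-refl)
    where
      take-i≡take-1+i =
        trans (take-all i l (≮⇒≥ i≮len)) (sym (take-all (suc i) l (m≤n⇒m≤1+n (≮⇒≥ i≮len))))
  ...   | yes i<len = xᵢ , d , ≢0∧≢1⇒2≤ d≢0 (earlier ≤-refl) , near
    where
      xᵢ = lookup l (fromℕ< i<len)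
      d = gcdL (take i l)
      l⊆S : ∀ {a} → a ∈ l → S a
      l⊆S a∈ = proj₂ (S≐l _) (⟨⟩-gen a∈)
      d≢0 : d ≢ 0
      d≢0 d≡0 = 1∉S (subst S xᵢ≡1 (l⊆S (∈-take⁻ (suc i) l (lookup-∈-take-suc i l i<len))))
        where
          xᵢ∣ : ∀ {a} → a ∈ take (suc i) l → xᵢ ∣ a
          xᵢ∣ a∈ with ∈-take-suc⁻ i l a∈
          ... | inj₁ a∈take =
            subst (xᵢ ∣_) (sym (0∣⇒≡0 (subst (_∣ _) d≡0 (gcdL-∣ (take i l) a∈take)))) (xᵢ ∣0)
          ... | inj₂ (_ , a≡xᵢ) = ∣-reflexive (sym a≡xᵢ)
          xᵢ≡1 : xᵢ ≡ 1
          xᵢ≡1 = ∣1⇒≡1 (subst (xᵢ ∣_) gcd≡1 (gcdL-greatest (take (suc i) l) xᵢ∣))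
      near : ∀ {y} → MinimalGenerator S y → d ∣ y ⊎ y ≡ xᵢ
      near mg with ∈-take-suc⁻ i l (minimalGenerator-∈ ns mg (l⊆S ∘ ∈-take⁻ (suc i) l)
                         (coprime-prefix-generates (s≤s z≤n) gcd≡1 (proj₁ (S≐l _) (proj₁ mg))))
      ... | inj₁ y∈ = inj₁ (gcdL-∣ (take i l) y∈)
      ... | inj₂ (_ , y≡x) = inj₂ y≡x

-- Multiplicity and genus of a free reflective semigroup

data Admissible : ℕ → ℕ → Set where
  two   : ∀ n → Admissible 2 (2 * n + 1)
  three : ∀ n → Admissible 3 (3 * n + 1)
  four  : ∀ n → Admissible 4 (4 * n + 1)

module Classification {S : ℕ → Set} (ns : IsNumericalSemigroup S) {x d : ℕ} (2≤d : 2 ≤ d)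
    (exceptional : ∀ {y} → MinimalGenerator S y → d ∣ y ⊎ y ≡ x) where

  coprime-pair-meets-x : ∀ {a b} → Coprime a b → MinimalGenerator S a → MinimalGenerator S b →
    a ≡ x ⊎ b ≡ x
  coprime-pair-meets-x coprime ga gb with exceptional ga | exceptional gb
  ... | inj₂ a≡x | _        = inj₁ a≡x
  ... | inj₁ _   | inj₂ b≡x = inj₂ b≡x
  ... | inj₁ d∣a | inj₁ d∣b = ⊥-elim (<⇒≢ 2≤d (sym (coprime (d∣a , d∣b))))

  no-coprime-triangle : ∀ {a b c} → Coprime a b → Coprime b c → Coprime a c →
    a ≢ b → b ≢ c → a ≢ c → MinimalGenerator S a → MinimalGenerator S b → MinimalGenerator S c → ⊥
  no-coprime-triangle ab bc ac a≢b b≢c a≢c ga gb gc with coprime-pair-meets-x ab ga gb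
  ... | inj₁ a≡x with coprime-pair-meets-x bc gb gc
  ...   | inj₁ b≡x = a≢b (trans a≡x (sym b≡x))
  ...   | inj₂ c≡x = a≢c (trans a≡x (sym c≡x))
  no-coprime-triangle ab bc ac a≢b b≢c a≢c ga gb gc | inj₂ b≡x with coprime-pair-meets-x ac ga gc
  ...   | inj₁ a≡x = a≢b (trans a≡x (sym b≡x))
  ...   | inj₂ c≡x = b≢c (trans b≡x (sym c≡x))

  no-disjoint-coprime-pairs : ∀ {a b c e} → Coprime a b → Coprime c e →
    c ≢ a → a ≢ e → c ≢ b → b ≢ e →
    MinimalGenerator S a → MinimalGenerator S b → MinimalGenerator S c → MinimalGenerator S e → ⊥
  no-disjoint-coprime-pairs ab ce c≢a a≢e c≢b b≢e ga gb gc ge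
    with coprime-pair-meets-x ab ga gb | coprime-pair-meets-x ce gc ge
  ... | inj₁ a≡x | inj₁ c≡x = c≢a (trans c≡x (sym a≡x))
  ... | inj₁ a≡x | inj₂ e≡x = a≢e (trans a≡x (sym e≡x))
  ... | inj₂ b≡x | inj₁ c≡x = c≢b (trans c≡x (sym b≡x))
  ... | inj₂ b≡x | inj₂ e≡x = b≢e (trans b≡x (sym e≡x))

  -- The minimal generators 2g + 1, g + 2 and 3 are pairwise coprime.
  no-shape-m3-g2 : ∀ q → ¬ ReflectiveShape S 3 (3 * q + 2)
  no-shape-m3-g2 q shape = no-coprime-triangle
    (coprime-by (q + 1) (suc (3 * q + 2 + (3 * q + 2))) (2 * q + 1) (3 * q + 2 + 2) (solve (q ∷ [])))
    (coprime-by 1 (3 * q + 2 + 2) (q + 1) 3 (solve (q ∷ [])))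
    (coprime-by 2 (suc (3 * q + 2 + (3 * q + 2))) (4 * q + 3) 3 (solve (q ∷ [])))
    (≢-offset (3 * q) (solve (q ∷ [])))
    (∤⇒≢ 3∤g+2)
    (≢-offset (6 * q + 1) (solve (q ∷ [])))
    (minimal-2g+1 (divides (q + 1) (solve (q ∷ []))))
    (minimal-above z<s (s<s (s<s z<s)) 3∤g+2)
    minimal-m
    where
      open ShapeProperties ns shape
      3∤g+2 : ¬ 3 ∣ 3 * q + 2 + 2
      3∤g+2 = ∤-near-multiple 1 (m∣m*n (q + 1)) (solve (q ∷ [])) z<s (s<s z<s)

  -- The minimal generators g + 3, g + 1 and 4 are pairwise coprime.
  no-shape-m4-g2 : ∀ q → ¬ ReflectiveShape S 4 (4 * q + 2)
  no-shape-m4-g2 q shape = no-coprime-triangle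
    (coprime-by (2 * q + 2) (4 * q + 2 + 3) (2 * q + 3) (4 * q + 2 + 1) (solve (q ∷ [])))
    (coprime-by 3 (4 * q + 2 + 1) (3 * q + 2) 4 (solve (q ∷ [])))
    (coprime-by 1 (4 * q + 2 + 3) (q + 1) 4 (solve (q ∷ [])))
    (≢-offset 1 (solve (q ∷ [])))
    (∤⇒≢ 4∤g+1)
    (∤⇒≢ 4∤g+3)
    (minimal-above z<s (s<s (s<s (s<s z<s))) 4∤g+3)
    (minimal-above z<s (s<s z<s) 4∤g+1)
    minimal-m
    where
      open ShapeProperties ns shape
      4∤g+1 : ¬ 4 ∣ 4 * q + 2 + 1
      4∤g+1 = ∤-near-multiple 3 (m∣m*n q) (solve (q ∷ [])) z<s (s<s (s<s (s<s z<s)))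
      4∤g+3 : ¬ 4 ∣ 4 * q + 2 + 3
      4∤g+3 = ∤-near-multiple 1 (m∣m*n (q + 1)) (solve (q ∷ [])) z<s (s<s z<s)

  -- The minimal generators g + 3, g + 2 and 2g + 1, 4 form two disjoint coprime pairs.
  no-shape-m4-g3 : ∀ q → ¬ ReflectiveShape S 4 (4 * q + 3)
  no-shape-m4-g3 q shape = no-disjoint-coprime-pairs
    (coprime-by 1 (4 * q + 3 + 3) 1 (4 * q + 3 + 2) (solve (q ∷ [])))
    (coprime-by 3 (suc (4 * q + 3 + (4 * q + 3))) (6 * q + 5) 4 (solve (q ∷ [])))
    (≢-offset (4 * q) (solve (q ∷ [])))
    (∤⇒≢ 4∤g+3)
    (≢-offset (4 * q + 1) (solve (q ∷ [])))
    (∤⇒≢ 4∤g+2)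
    (minimal-above z<s (s<s (s<s (s<s z<s))) 4∤g+3)
    (minimal-above z<s (s<s (s<s z<s)) 4∤g+2)
    (minimal-2g+1 (divides (q + 1) (solve (q ∷ []))))
    minimal-m
    where
      open ShapeProperties ns shape
      4∤g+2 : ¬ 4 ∣ 4 * q + 3 + 2
      4∤g+2 = ∤-near-multiple 1 (m∣m*n (q + 1)) (solve (q ∷ [])) z<s (s<s z<s)
      4∤g+3 : ¬ 4 ∣ 4 * q + 3 + 3
      4∤g+3 = ∤-near-multiple 2 (m∣m*n (q + 1)) (solve (q ∷ [])) z<s (s<s (s<s z<s))

  -- Each of g + 1, …, g + 4 is divisible by d, or is x, or is a multiple of m = x.  No two
  -- consecutive ones are divisible by d, and no two of them fall into the other cases.
  no-shape-m≥5 : ∀ {m g} → 5 ≤ m → ¬ ReflectiveShape S m g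
  no-shape-m≥5 {m} {g} 5≤m shape = impossible
    (position 1 z<s (s≤s z≤n)) (position 2 z<s (s≤s (s≤s z≤n)))
    (position 3 z<s (s≤s (s≤s (s≤s z≤n)))) (position 4 z<s ≤-refl)
    where
      open ShapeProperties ns shape
      Good Bad : ℕ → Set
      Good z = d ∣ g + z
      Bad  z = g + z ≡ x ⊎ (m ∣ g + z × m ≡ x)

      position : ∀ z → 1 ≤ z → z ≤ 4 → Good z ⊎ Bad z
      position z 0<z z≤4 with m ∣? g + z | exceptional minimal-m
      ... | yes m∣g+z | inj₁ d∣m = inj₁ (∣-trans d∣m m∣g+z)
      ... | yes m∣g+z | inj₂ m≡x = inj₂ (inj₂ (m∣g+z , m≡x))
      ... | no  m∤g+z | _ with exceptional (minimal-above 0<z (<-≤-trans (s≤s z≤4) 5≤m) m∤g+z)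
      ...   | inj₁ d∣g+z = inj₁ d∣g+z
      ...   | inj₂ g+z≡x = inj₂ (inj₁ g+z≡x)

      good-good : ∀ z → Good z → Good (z + 1) → ⊥
      good-good z d∣g+z = ∤-near-multiple 1 d∣g+z (sym (+-assoc g z 1)) z<s 2≤d

      two-multiples : ∀ {z} w → 0 < w → w < 5 → m ∣ g + z → m ∣ g + (z + w) → ⊥
      two-multiples {z} w 0<w w<5 m∣g+z = ∤-near-multiple w m∣g+z (sym (+-assoc g z w)) 0<w (<-≤-trans w<5 5≤m)

      bad-bad : ∀ z w → 0 < w → w < 5 → Bad z → Bad (z + w) → ⊥
      bad-bad z w 0<w w<5 (inj₁ g+z≡x) (inj₁ g+z+w≡x) =
        <⇒≢ (m<m+n z 0<w) (+-cancelˡ-≡ g _ _ (trans g+z≡x (sym g+z+w≡x)))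
      bad-bad z w 0<w w<5 (inj₁ g+z≡x) (inj₂ (m∣g+z+w , m≡x)) =
        two-multiples w 0<w w<5 (∣-reflexive (trans m≡x (sym g+z≡x))) m∣g+z+w
      bad-bad z w 0<w w<5 (inj₂ (m∣g+z , m≡x)) (inj₁ g+z+w≡x) =
        two-multiples w 0<w w<5 m∣g+z (∣-reflexive (trans m≡x (sym g+z+w≡x)))
      bad-bad z w 0<w w<5 (inj₂ (m∣g+z , _)) (inj₂ (m∣g+z+w , _)) =
        two-multiples w 0<w w<5 m∣g+z m∣g+z+w

      impossible : Good 1 ⊎ Bad 1 → Good 2 ⊎ Bad 2 → Good 3 ⊎ Bad 3 → Good 4 ⊎ Bad 4 → ⊥
      impossible (inj₁ g₁) (inj₁ g₂) _         _         = good-good 1 g₁ g₂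
      impossible _         _         (inj₁ g₃) (inj₁ g₄) = good-good 3 g₃ g₄
      impossible (inj₂ b₁) _         (inj₂ b₃) _         = bad-bad 1 2 z<s (s≤s (s≤s (s≤s z≤n))) b₁ b₃
      impossible (inj₂ b₁) _         _         (inj₂ b₄) = bad-bad 1 3 z<s (s≤s (s≤s (s≤s (s≤s z≤n)))) b₁ b₄
      impossible _         (inj₂ b₂) (inj₂ b₃) _         = bad-bad 2 1 z<s (s≤s (s≤s z≤n)) b₂ b₃
      impossible _         (inj₂ b₂) _         (inj₂ b₄) = bad-bad 2 2 z<s (s≤s (s≤s (s≤s z≤n))) b₂ b₄

  classify : ∀ {m g} → ReflectiveShape S m g → Admissible m g
  classify {0} shape = ⊥-elim (n≮n 0 (ReflectiveShape.0<m shape))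
  classify {1} shape = ⊥-elim (n≮n 1 (ShapeProperties.2≤m ns shape))
  classify {2} {g} shape with divMod g (z<s {1})
  ... | q , 0 , _ , refl = ⊥-elim (ShapeProperties.m∤g ns shape (divides q (solve (q ∷ []))))
  ... | q , 1 , _ , refl = two q
  ... | _ , suc (suc _) , s≤s (s≤s ()) , _
  classify {3} {g} shape with divMod g (z<s {2})
  ... | q , 0 , _ , refl = ⊥-elim (ShapeProperties.m∤g ns shape (divides q (solve (q ∷ []))))
  ... | q , 1 , _ , refl = three q
  ... | q , 2 , _ , refl = ⊥-elim (no-shape-m3-g2 q shape)
  ... | _ , suc (suc (suc _)) , s≤s (s≤s (s≤s ())) , _
  classify {4} {g} shape with divMod g (z<s {3})
  ... | q , 0 , _ , refl = ⊥-elim (ShapeProperties.m∤g ns shape (divides q (solve (q ∷ []))))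
  ... | q , 1 , _ , refl = four q
  ... | q , 2 , _ , refl = ⊥-elim (no-shape-m4-g2 q shape)
  ... | q , 3 , _ , refl = ⊥-elim (no-shape-m4-g3 q shape)
  ... | _ , suc (suc (suc (suc _))) , s≤s (s≤s (s≤s (s≤s ()))) , _
  classify {suc (suc (suc (suc (suc _))))} shape = ⊥-elim (no-shape-m≥5 (s≤s (s≤s (s≤s (s≤s (s≤s z≤n))))) shape)

-- The three families

≐⟨⟩-by-residues : ∀ {m g A} → IsNumericalSemigroup S → ReflectiveShape S m g →
  (∀ {a} → a ∈ A → S a) → m ∈ A →
  (∀ {r} → 0 < r → r < m → ⟨ A ⟩ₗ (g + r)) → (∀ {r} → r < m → ⟨ A ⟩ₗ (g + g + r)) →
  S ≐ ⟨ A ⟩ₗ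
≐⟨⟩-by-residues {S} {m} {g} {A} ns shape A⊆S m∈A middle top _ = generated , ⟨⟩-⊆ ns A⊆S
  where
    open ReflectiveShape shape

    shift : ∀ b {r y} q → y ≡ b + (m * q + r) → ⟨ A ⟩ₗ (b + r) → ⟨ A ⟩ₗ y
    shift b {r} q y≡ b+r∈ =
      subst ⟨ A ⟩ₗ (sym y≡) (⟨⟩-via (⟨⟩-+ b+r∈ (⟨⟩-* q m∈A)) (solve (b ∷ r ∷ q ∷ m ∷ [])))

    generated : S y → ⟨ A ⟩ₗ y
    generated {y} y∈S with y <? g | y <? g + g
    ... | yes y<g | _ with m∣-below-g y<g y∈S
    ...   | divides k refl = ⟨⟩-* k m∈A
    generated {y} y∈S | no y≮g | yes y<2g with divMod (y ∸ g) 0<m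
    ... | q , zero , _ , z≡ = ⊥-elim (m∤-above-g z<g (subst S (sym g+z≡y) y∈S)
                                (divides q (trans z≡ (trans (+-identityʳ _) (*-comm m q)))))
      where
        g+z≡y = m+[n∸m]≡n (≮⇒≥ y≮g)
        z<g = +-cancelˡ-< g _ _ (subst (_< g + g) (sym g+z≡y) y<2g)
    ... | q , suc r , r<m , z≡ =
      shift g q (trans (sym (m+[n∸m]≡n (≮⇒≥ y≮g))) (cong (g +_) z≡)) (middle z<s r<m)
    generated {y} y∈S | no y≮g | no y≮2g with divMod (y ∸ (g + g)) 0<m
    ... | q , r , r<m , w≡ =
      shift (g + g) q (trans (sym (m+[n∸m]≡n (≮⇒≥ y≮2g))) (cong (g + g +_) w≡)) (top r<m)

module _ {S : ℕ → Set} (ns : IsNumericalSemigroup S) where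

  ≐⟨2,4n+3⟩ : ∀ n → ReflectiveShape S 2 (2 * n + 1) → S ≐ ⟨ 2 ∷ 4 * n + 3 ∷ [] ⟩ₗ
  ≐⟨2,4n+3⟩ n shape = ≐⟨⟩-by-residues ns shape A⊆S (here refl) middle top
    where
      open ReflectiveShape shape
      A⊆S : ∀ {a} → a ∈ 2 ∷ 4 * n + 3 ∷ [] → S a
      A⊆S (here refl)         = m∈S
      A⊆S (there (here refl)) = subst S 2g+1≡4n+3 (conductor (n≤1+n _))
        where
          2g+1≡4n+3 : suc (2 * n + 1 + (2 * n + 1)) ≡ 4 * n + 3
          2g+1≡4n+3 = solve (n ∷ [])
      middle : ∀ {r} → 0 < r → r < 2 → ⟨ 2 ∷ 4 * n + 3 ∷ [] ⟩ₗ (2 * n + 1 + r)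
      middle {1} _ _ = ⟨⟩-via (⟨⟩-* (n + 1) (here refl)) (solve (n ∷ []))
      middle {suc (suc _)} _ (s≤s (s≤s ()))
      top : ∀ {r} → r < 2 → ⟨ 2 ∷ 4 * n + 3 ∷ [] ⟩ₗ (2 * n + 1 + (2 * n + 1) + r)
      top {0} _ = ⟨⟩-via (⟨⟩-* (2 * n + 1) (here refl)) (solve (n ∷ []))
      top {1} _ = ⟨⟩-via (⟨⟩-gen (there (here refl))) (solve (n ∷ []))
      top {suc (suc _)} (s≤s (s≤s ()))

  ≐⟨3,3n+2⟩ : ∀ n → ReflectiveShape S 3 (3 * n + 1) → S ≐ ⟨ 3 ∷ 3 * n + 2 ∷ [] ⟩ₗ
  ≐⟨3,3n+2⟩ n shape = ≐⟨⟩-by-residues ns shape A⊆S (here refl) middle top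
    where
      open ReflectiveShape shape
      A⊆S : ∀ {a} → a ∈ 3 ∷ 3 * n + 2 ∷ [] → S a
      A⊆S (here refl)         = m∈S
      A⊆S (there (here refl)) = subst S (+-assoc (3 * n) 1 1) (above-g∈S z<s (s<s z<s))
      middle : ∀ {r} → 0 < r → r < 3 → ⟨ 3 ∷ 3 * n + 2 ∷ [] ⟩ₗ (3 * n + 1 + r)
      middle {1} _ _ = ⟨⟩-via (⟨⟩-gen (there (here refl))) (solve (n ∷ []))
      middle {2} _ _ = ⟨⟩-via (⟨⟩-* (n + 1) (here refl)) (solve (n ∷ []))
      middle {suc (suc (suc _))} _ (s≤s (s≤s (s≤s ())))
      top : ∀ {r} → r < 3 → ⟨ 3 ∷ 3 * n + 2 ∷ [] ⟩ₗ (3 * n + 1 + (3 * n + 1) + r)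
      top {0} _ = ⟨⟩-via (⟨⟩-+ (⟨⟩-gen (there (here refl))) (⟨⟩-* n (here refl))) (solve (n ∷ []))
      top {1} _ = ⟨⟩-via (⟨⟩-* (2 * n + 1) (here refl)) (solve (n ∷ []))
      top {2} _ = ⟨⟩-via (⟨⟩-+ (⟨⟩-gen (there (here refl))) (⟨⟩-gen (there (here refl)))) (solve (n ∷ []))
      top {suc (suc (suc _))} (s≤s (s≤s (s≤s ())))

  multiplicity-4⇒1≤n : ∀ n → ReflectiveShape S 4 (4 * n + 1) → 1 ≤ n
  multiplicity-4⇒1≤n zero    shape = contradiction (ShapeProperties.m≤g+1 ns shape) λ { (s≤s (s≤s ())) }
  multiplicity-4⇒1≤n (suc _) _     = s≤s z≤n

  ≐⟨4,4n+2,4n+3⟩ : ∀ n → ReflectiveShape S 4 (4 * n + 1) → S ≐ ⟨ 4 ∷ 4 * n + 2 ∷ 4 * n + 3 ∷ [] ⟩ₗ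
  ≐⟨4,4n+2,4n+3⟩ n shape = ≐⟨⟩-by-residues ns shape A⊆S (here refl) middle top
    where
      open ReflectiveShape shape
      A⊆S : ∀ {a} → a ∈ 4 ∷ 4 * n + 2 ∷ 4 * n + 3 ∷ [] → S a
      A⊆S (here refl)                 = m∈S
      A⊆S (there (here refl))         = subst S (+-assoc (4 * n) 1 1) (above-g∈S z<s (s<s z<s))
      A⊆S (there (there (here refl))) = subst S (+-assoc (4 * n) 1 2) (above-g∈S z<s (s<s (s<s z<s)))
      middle : ∀ {r} → 0 < r → r < 4 → ⟨ 4 ∷ 4 * n + 2 ∷ 4 * n + 3 ∷ [] ⟩ₗ (4 * n + 1 + r)
      middle {1} _ _ = ⟨⟩-via (⟨⟩-gen (there (here refl))) (solve (n ∷ []))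
      middle {2} _ _ = ⟨⟩-via (⟨⟩-gen (there (there (here refl)))) (solve (n ∷ []))
      middle {3} _ _ = ⟨⟩-via (⟨⟩-* (n + 1) (here refl)) (solve (n ∷ []))
      middle {suc (suc (suc (suc _)))} _ (s≤s (s≤s (s≤s (s≤s ()))))
      top : ∀ {r} → r < 4 → ⟨ 4 ∷ 4 * n + 2 ∷ 4 * n + 3 ∷ [] ⟩ₗ (4 * n + 1 + (4 * n + 1) + r)
      top {0} _ = ⟨⟩-via (⟨⟩-+ (⟨⟩-gen (there (here refl))) (⟨⟩-* n (here refl))) (solve (n ∷ []))
      top {1} _ = ⟨⟩-via (⟨⟩-+ (⟨⟩-gen (there (there (here refl)))) (⟨⟩-* n (here refl))) (solve (n ∷ []))
      top {2} _ = ⟨⟩-via (⟨⟩-* (2 * n + 1) (here refl)) (solve (n ∷ []))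
      top {3} _ = ⟨⟩-via (⟨⟩-+ (⟨⟩-gen (there (here refl))) (⟨⟩-gen (there (there (here refl))))) (solve (n ∷ []))
      top {suc (suc (suc (suc _)))} (s≤s (s≤s (s≤s (s≤s ()))))

minimal-1 : IsMinimal (1 ∷ [])
minimal-1 _ (here refl) = ¬⟨others⟩-by-divisor 2 (from-no (2 ∣? 1)) λ where
    (here refl) 1≢1 _ → contradiction refl 1≢1

minimal-2,4n+3 : ∀ n → IsMinimal (2 ∷ 4 * n + 3 ∷ [])
minimal-2,4n+3 n _ (here refl) = ¬⟨others⟩-by-divisor 3 (from-no (3 ∣? 2)) λ where
    (here refl)         2≢2 _      → contradiction refl 2≢2
    (there (here refl)) _   4n+3≤2 → contradiction 4n+3≤2 (<⇒≱ (m≤n+m 3 (4 * n)))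
minimal-2,4n+3 n _ (there (here refl)) = ¬⟨others⟩-by-divisor 2 2∤4n+3 λ where
    (here refl)         _         _ → ∣-refl
    (there (here refl)) 4n+3≢4n+3 _ → contradiction refl 4n+3≢4n+3
  where
    2∤4n+3 : ¬ 2 ∣ 4 * n + 3
    2∤4n+3 = ∤-near-multiple 1 (m∣m*n (2 * n + 1)) (solve (n ∷ [])) z<s (s<s z<s)

minimal-3,3n+2 : ∀ n → IsMinimal (3 ∷ 3 * n + 2 ∷ [])
minimal-3,3n+2 n _ (here refl) = ¬⟨others⟩-by-divisor 2 (from-no (2 ∣? 3)) λ where
    (here refl)         3≢3 _      → contradiction refl 3≢3
    (there (here refl)) _   3n+2≤3 → small n 3n+2≤3
  where
    small : ∀ n → 3 * n + 2 ≤ 3 → 2 ∣ 3 * n + 2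
    small zero    _      = ∣-refl
    small (suc n) 3n+2≤3 =
      contradiction 3n+2≤3 (<⇒≱ (≤-trans (s≤s (s≤s (s≤s (s≤s z≤n)))) (+-monoˡ-≤ 2 (m≤m*n 3 (suc n)))))
minimal-3,3n+2 n _ (there (here refl)) = ¬⟨others⟩-by-divisor 3 3∤3n+2 λ where
    (here refl)         _         _ → ∣-refl
    (there (here refl)) 3n+2≢3n+2 _ → contradiction refl 3n+2≢3n+2
  where
    3∤3n+2 : ¬ 3 ∣ 3 * n + 2
    3∤3n+2 = ∤-near-multiple 2 (m∣m*n n) (solve (n ∷ [])) z<s (s<s (s<s z<s))

minimal-4,4n+2,4n+3 : ∀ n → 1 ≤ n → IsMinimal (4 ∷ 4 * n + 2 ∷ 4 * n + 3 ∷ [])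
minimal-4,4n+2,4n+3 n 1≤n _ (here refl) = ¬⟨others⟩-by-divisor 3 (from-no (3 ∣? 4)) λ where
    (here refl)                 4≢4 _      → contradiction refl 4≢4
    (there (here refl))         _   4n+2≤4 → contradiction 4n+2≤4 (<⇒≱ (4<4n+ 1))
    (there (there (here refl))) _   4n+3≤4 → contradiction 4n+3≤4 (<⇒≱ (4<4n+ 2))
  where
    4<4n+ : ∀ r → 4 < 4 * n + suc r
    4<4n+ r = ≤-trans (m≤m+n 5 r) (+-monoˡ-≤ (suc r) (m≤m*n 4 n ⦃ >-nonZero 1≤n ⦄))
minimal-4,4n+2,4n+3 n _ _ (there (here refl)) = ¬⟨others⟩-by-divisor 4 4∤4n+2 λ where
    (here refl)                 _         _      → ∣-refl
    (there (here refl))         4n+2≢4n+2 _      → contradiction refl 4n+2≢4n+2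
    (there (there (here refl))) _         4n+3≤4n+2 → contradiction 4n+3≤4n+2 (<⇒≱ (+-monoʳ-< (4 * n) (n<1+n 2)))
  where
    4∤4n+2 : ¬ 4 ∣ 4 * n + 2
    4∤4n+2 = ∤-near-multiple 2 (m∣m*n n) (solve (n ∷ [])) z<s (s<s (s<s z<s))
minimal-4,4n+2,4n+3 n _ _ (there (there (here refl))) = ¬⟨others⟩-by-divisor 2 2∤4n+3 λ where
    (here refl)                 _         _ → divides 2 refl
    (there (here refl))         _         _ → divides (2 * n + 1) (solve (n ∷ []))
    (there (there (here refl))) 4n+3≢4n+3 _ → contradiction refl 4n+3≢4n+3
  where
    2∤4n+3 : ¬ 2 ∣ 4 * n + 3
    2∤4n+3 = ∤-near-multiple 1 (m∣m*n (2 * n + 1)) (solve (n ∷ [])) z<s (s<s z<s)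

ordered-telescopic : ∀ {A} → IsTelescopicSeq A → IsTelescopicSet A
ordered-telescopic {A} telescopic = A , ↭-refl , telescopic

telescopic-1 : IsTelescopicSet (1 ∷ [])
telescopic-1 = ordered-telescopic λ { (suc _) _ (s≤s ()) }

telescopic-pair : ∀ {a b} → Coprime a b → IsTelescopicSeq (a ∷ b ∷ [])
telescopic-pair {a} {b} coprime 1 _ _ = ⟨⟩-via (⟨⟩-* b (here refl)) (begin
  b * a                                     ≡⟨ *-comm b a ⟩
  a * b                                     ≡⟨ cong (_* b) (sym (n/1≡n a)) ⟩
  (a div 1) * b
    ≡⟨ cong₂ (λ c c′ → (c div c′) * b) (sym (gcdL-singleton a)) (sym gcd≡1) ⟩
  (gcdL (a ∷ []) div gcdL (a ∷ b ∷ [])) * b ∎)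
  where
    open ≡-Reasoning
    gcd≡1 : gcdL (a ∷ b ∷ []) ≡ 1
    gcd≡1 = coprime (gcdL-∣ (a ∷ b ∷ []) (here refl) , gcdL-∣ (a ∷ b ∷ []) (there (here refl)))
telescopic-pair _ (suc (suc _)) _ (s≤s (s≤s ()))

telescopic-2,4n+3 : ∀ n → IsTelescopicSet (2 ∷ 4 * n + 3 ∷ [])
telescopic-2,4n+3 n =
  ordered-telescopic (telescopic-pair (coprime-sym (coprime-by 1 (4 * n + 3) (2 * n + 1) 2 (solve (n ∷ [])))))

telescopic-3,3n+2 : ∀ n → IsTelescopicSet (3 ∷ 3 * n + 2 ∷ [])
telescopic-3,3n+2 n =
  ordered-telescopic (telescopic-pair (coprime-sym (coprime-by 2 (3 * n + 2) (2 * n + 1) 3 (solve (n ∷ [])))))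

gcdL-4,4n+2 : ∀ n → gcdL (4 ∷ 4 * n + 2 ∷ []) ≡ 2
gcdL-4,4n+2 n = ∣-antisym
  (∣m+n∣m⇒∣n (subst (gcdL L ∣_) 4[n+1]≡4n+2+2 (∣m⇒∣m*n (n + 1) (gcdL-∣ L (here refl))))
             (gcdL-∣ L (there (here refl))))
  (gcdL-greatest L λ where
    (here refl)         → divides 2 refl
    (there (here refl)) → divides (2 * n + 1) (solve (n ∷ [])))
  where
    L = 4 ∷ 4 * n + 2 ∷ []
    4[n+1]≡4n+2+2 : 4 * (n + 1) ≡ 4 * n + 2 + 2
    4[n+1]≡4n+2+2 = solve (n ∷ [])

telescopicSeq-4,4n+2,4n+3 : ∀ n → IsTelescopicSeq (4 ∷ 4 * n + 2 ∷ 4 * n + 3 ∷ [])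
telescopicSeq-4,4n+2,4n+3 n 1 _ _ = ⟨⟩-via (⟨⟩-* (2 * n + 1) (here refl)) (begin
  (2 * n + 1) * 4
    ≡⟨ solve (n ∷ []) ⟩
  2 * (4 * n + 2)
    ≡⟨ cong₂ (λ c c′ → (c div c′) * (4 * n + 2)) (sym (gcdL-singleton 4)) (sym (gcdL-4,4n+2 n)) ⟩
  (gcdL (4 ∷ []) div gcdL (4 ∷ 4 * n + 2 ∷ [])) * (4 * n + 2) ∎)
  where open ≡-Reasoning
telescopicSeq-4,4n+2,4n+3 n 2 _ _ = ⟨⟩-via (⟨⟩-+ (⟨⟩-gen (there (here refl))) (⟨⟩-* (n + 1) (here refl))) (begin
  4 * n + 2 + (n + 1) * 4
    ≡⟨ solve (n ∷ []) ⟩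
  2 * (4 * n + 3)
    ≡⟨ cong₂ (λ c c′ → (c div c′) * (4 * n + 3)) (sym (gcdL-4,4n+2 n)) (sym gcdL-A≡1) ⟩
  (gcdL (4 ∷ 4 * n + 2 ∷ []) div gcdL A) * (4 * n + 3) ∎)
  where
    open ≡-Reasoning
    A = 4 ∷ 4 * n + 2 ∷ 4 * n + 3 ∷ []
    gcdL-A≡1 : gcdL A ≡ 1
    gcdL-A≡1 = ∣1⇒≡1 (∣m+n∣m⇒∣n
      (subst (gcdL A ∣_) (sym (+-assoc (4 * n) 2 1)) (gcdL-∣ A (there (there (here refl)))))
      (gcdL-∣ A (there (here refl))))
telescopicSeq-4,4n+2,4n+3 _ (suc (suc (suc _))) _ (s≤s (s≤s (s≤s ())))

telescopic-4,4n+2,4n+3 : ∀ n → IsTelescopicSet (4 ∷ 4 * n + 2 ∷ 4 * n + 3 ∷ [])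
telescopic-4,4n+2,4n+3 n = ordered-telescopic (telescopicSeq-4,4n+2,4n+3 n)

genus-zero-≐⟨1⟩ : Decidable S → HasGenus S 0 → S ≐ ⟨ 1 ∷ [] ⟩ₗ
genus-zero-≐⟨1⟩ _ (_ ∷ _ , _ , _ , ()) _
genus-zero-≐⟨1⟩ {S} S? ([] , _ , gaps , _) y =
  (λ _ → ⟨⟩-via (⟨⟩-* y (here refl)) (*-identityʳ y)) , λ _ → y∈S
  where
    y∈S : S y
    y∈S with S? y
    ... | yes y∈S = y∈S
    ... | no  y∉S with proj₂ (gaps y) y∉S
    ...   | ()

proposition4p19 : (S : ℕ → Set) → IsNumericalSemigroup S → IsFree S → IsReflective S →
    Σ (List ℕ) λ A → (S ≐ ⟨ A ⟩ₗ) × IsMinimal A × IsTelescopicSet A ×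
      ((A ≡ 1 ∷ [] × HasGenus S 0)
      ⊎ (Σ ℕ λ n → A ≡ 2 ∷ 4 * n + 3 ∷ [] × HasGenus S (2 * n + 1))
      ⊎ (Σ ℕ λ n → A ≡ 3 ∷ 3 * n + 2 ∷ [] × HasGenus S (3 * n + 1))
      ⊎ (Σ ℕ λ n → A ≡ 4 ∷ 4 * n + 2 ∷ 4 * n + 3 ∷ [] × HasGenus S (4 * n + 1)))
proposition4p19 S ns (A , _ , (l , l↭A , telescopic) , S≐A) reflective with ≐⟨⟩ₗ-decidable S≐A
... | S? with genus S? ns
...   | g , hg with 0 <? g
...     | no g≯0 rewrite n≤0⇒n≡0 (≮⇒≥ g≯0) =
  1 ∷ [] , genus-zero-≐⟨1⟩ S? hg , minimal-1 , telescopic-1 , inj₁ (refl , hg)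
...     | yes 0<g with reflective-shape S? ns hg 0<g (reflective g hg 0<g)
...       | _ , shape
          with Telescopic.exceptional-generator telescopic ns (≐-resp-↭ l↭A S≐A) (ShapeProperties.1∉S ns shape)
...         | _ , _ , 2≤d , exceptional with Classification.classify ns 2≤d exceptional shape
...           | two n   = _ , ≐⟨2,4n+3⟩ ns n shape , minimal-2,4n+3 n , telescopic-2,4n+3 n ,
                          inj₂ (inj₁ (n , refl , hg))
...           | three n = _ , ≐⟨3,3n+2⟩ ns n shape , minimal-3,3n+2 n , telescopic-3,3n+2 n ,
                          inj₂ (inj₂ (inj₁ (n , refl , hg)))
...           | four n  = _ , ≐⟨4,4n+2,4n+3⟩ ns n shape , minimal-4,4n+2,4n+3 n (multiplicity-4⇒1≤n ns n shape) ,
                          telescopic-4,4n+2,4n+3 n , inj₂ (inj₂ (inj₂ (n , refl , hg)))
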